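{- Let $1\le r<n/2$ and let $\mathcal{F}\subseteq\binom{[n]}{r}$ be intersecting with $|\mathcal{F}|=\binom{n-1}{r-1}$. Let $i,j\in[n]$ and suppose $\sigma_{j,i}(\mathcal{F})=\binom{[n]}{r}_i$. Put $M=[n]\setminus\{i,j\}$. Then: (1) if $A,C\in\binom{M}{r-1}$, $A\cap C=\emptyset$, and $A\cup\{j\}\in\mathcal{F}$, then $C\cup\{j\}\in\mathcal{F}$; (2) if $A,B\in\binom{M}{r-1}$, $|A\triangle B|=2$, and $A\cup\{j\}\in\mathcal{F}$, then $B\cup\{j\}\in\mathcal{F}$.
   Context: $[n]=\{1,\dots,n\}$, $\binom{X}{r}$ is the family of $r$-element subsets of $X$, and $\binom{[n]}{r}_x=\{F\in\binom{[n]}{r}:x\in F\}$ is the full star centered at $x$. A family is intersecting if any two of its members intersect. For $a,b\in[n]$ and $A\subseteq[n]$, $\sigma_{a,b}(A)=(A\setminus\{a\})\cup\{b\}$ if $a\in A$, $b\notin A$, and $\sigma_{a,b}(A)=A$ otherwise; for a family $\mathcal{F}$, $\sigma_{a,b}(\mathcal{F})=\{\sigma'_{a,b}(A):A\in\mathcal{F}\}$ where $\sigma'_{a,b}(A)=\sigma_{a,b}(A)$ if $\sigma_{a,b}(A)\notin\mathcal{F}$ and $\sigma'_{a,b}(A)=A$ otherwise. -}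

module Defs where

open import Data.Nat using (ℕ; _*_; _<_; _≤_; _∸_)
open import Data.Nat.Combinatorics using (_C_)
open import Data.Bool using (Bool; true; false; if_then_else_; _∧_; not)
open import Data.Bool.Properties using () renaming (_≟_ to _≟ᵇ_)
open import Data.Fin using (Fin)
open import Data.Fin.Subset using (Subset; _∈_; _∉_; _∩_; _∪_; _─_; ∣_∣; ⁅_⁆; Nonempty; Empty; ⊤)
open import Data.Vec using (lookup; _[_]≔_)
open import Data.Vec.Properties using (≡-dec)
open import Data.List using (List; map; length)
open import Data.List.Relation.Unary.All using (All)
open import Data.List.Relation.Unary.Unique.Propositional using (Unique)
open import Data.Product using (_×_)
open import Relation.Binary.PropositionalEquality using (_≡_)
open import Relation.Binary.Definitions using (DecidableEquality)
open import Relation.Nullary.Decidable using (does)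
import Data.List.Membership.Propositional as LMem
import Data.List.Membership.DecPropositional as DMem

-- Ground set [n] is represented by Fin n; subsets of [n] by Subset n.
-- A family of subsets is a duplicate-free list of subsets (a finite set).

_≟ˢ_ : ∀ {n} → DecidableEquality (Subset n)
_≟ˢ_ = ≡-dec _≟ᵇ_

_∈ᶠ_ : ∀ {n} → Subset n → List (Subset n) → Set
A ∈ᶠ 𝓕 = LMem._∈_ A 𝓕

_∈ᶠ?_ : ∀ {n} → Subset n → List (Subset n) → Bool
A ∈ᶠ? 𝓕 = does (DMem._∈?_ _≟ˢ_ A 𝓕)

σ : ∀ {n} → Fin n → Fin n → Subset n → Subset n
σ a b A = if lookup A a ∧ not (lookup A b)
          then (A [ a ]≔ false) [ b ]≔ true
          else A

σ' : ∀ {n} → Fin n → Fin n → List (Subset n) → Subset n → Subset n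
σ' a b 𝓕 A = if σ a b A ∈ᶠ? 𝓕 then A else σ a b A

σᶠ : ∀ {n} → Fin n → Fin n → List (Subset n) → List (Subset n)
σᶠ a b 𝓕 = map (σ' a b 𝓕) 𝓕

Uniform : ∀ {n} → ℕ → List (Subset n) → Set
Uniform r 𝓕 = All (λ A → ∣ A ∣ ≡ r) 𝓕

Intersecting : ∀ {n} → List (Subset n) → Set
Intersecting 𝓕 = ∀ {A B} → A ∈ᶠ 𝓕 → B ∈ᶠ 𝓕 → Nonempty (A ∩ B)

IsFullStar : ∀ {n} → ℕ → Fin n → List (Subset n) → Set
IsFullStar r x 𝓖 = ∀ S → (S ∈ᶠ 𝓖 → (∣ S ∣ ≡ r × x ∈ S)) × ((∣ S ∣ ≡ r × x ∈ S) → S ∈ᶠ 𝓖)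

_△_ : ∀ {n} → Subset n → Subset n → Subset n
A △ B = (A ─ B) ∪ (B ─ A)

-- Since σ_{j,i}(𝓕) is the full star at i, every X ∪ {i} with X an (r-1)-subset of M lies in
-- σ_{j,i}(𝓕), so either X ∪ {i} ∈ 𝓕 or it is the shift of X ∪ {j} ∈ 𝓕. In (1) the first
-- alternative for X = C is excluded by intersection: C ∪ {i} misses A ∪ {j} unless i = j.
-- In (2), A ∪ B has r elements, so n > 2r leaves room for an (r-1)-set T ⊆ M disjoint from
-- both A and B, and two applications of (1), A → T → B, give the claim.
module Submission where

open import Defs
open import Data.Nat using (ℕ; _*_; _<_; _≤_; _∸_)
open import Data.Nat.Combinatorics using (_C_)
open import Data.Fin using (Fin)
open import Data.Fin.Subset using (Subset; _∈_; _∉_; _∩_; _∪_; _─_; _⊆_; ∣_∣; ⁅_⁆; Empty; ⊤)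
open import Data.List using (List; length)
open import Data.List.Relation.Unary.Unique.Propositional using (Unique)
open import Data.Product using (_×_)
open import Relation.Binary.PropositionalEquality using (_≡_)

open import Data.Bool using (true; false; _∨_)
open import Data.Bool.Properties using (∨-identityʳ; ∨-zeroʳ)
open import Data.Fin using (zero; suc)
open import Data.Fin.Properties using (_≟_)
open import Data.Fin.Subset using (∁; Nonempty; ⊥)
open import Data.Fin.Subset.Properties
import Data.List as List
open import Data.List.Membership.Propositional.Properties using (∈-map⁻)
open import Data.Nat using (suc; zero; _+_; s≤s; z≤n; ⌊_/2⌋)
open import Data.Nat.Properties
  using (+-suc; n≡⌊n+n/2⌋; ≤-trans; ≤-reflexive; n≤1+n; +-monoʳ-≤; +-monoˡ-≤; m+n≤o⇒m≤o∸n; module ≤-Reasoning)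
open import Data.Nat.Tactic.RingSolver using (solve-∀; solve)
open import Data.Product using (∃-syntax; _,_; proj₂)
open import Data.Sum using (_⊎_; inj₁; inj₂; [_,_])
open import Data.Vec using (_∷_; []; here; there; lookup; _[_]≔_)
open import Data.Vec.Properties using (lookup-zipWith; lookup∘update′; []=⇒lookup; lookup⇒[]=)
open import Data.Vec.Relation.Binary.Pointwise.Extensional using (ext; Pointwise-≡⇒≡)
open import Function using (id; _∘_)
open import Relation.Nullary using (yes; no; contradiction)
open import Relation.Binary.PropositionalEquality using (refl; sym; trans; cong; cong₂; subst; _≢_; module ≡-Reasoning)

lookup-∉ : ∀ {n} {p : Subset n} {x} → x ∉ p → lookup p x ≡ false
lookup-∉ {p = p} {x} x∉p with lookup p x in eq
... | false = refl
... | true  = contradiction (lookup⇒[]= x p eq) x∉p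

x∈p─q⇒x∉q : ∀ {n} (p q : Subset n) {x} → x ∈ p ─ q → x ∉ q
x∈p─q⇒x∉q (_ ∷ p) (true  ∷ q) {zero}  ()
x∈p─q⇒x∉q (_ ∷ p) (false ∷ q) {zero}  _               ()
x∈p─q⇒x∉q (_ ∷ p) (_     ∷ q) {suc x} (there x∈p─q) (there x∈q) = x∈p─q⇒x∉q p q x∈p─q x∈q

lookup-∪⁅x⁆-self : ∀ {n} (p : Subset n) x → lookup (p ∪ ⁅ x ⁆) x ≡ true
lookup-∪⁅x⁆-self p x = begin
  lookup (p ∪ ⁅ x ⁆) x         ≡⟨ lookup-zipWith _∨_ x p ⁅ x ⁆ ⟩
  lookup p x ∨ lookup ⁅ x ⁆ x  ≡⟨ cong (lookup p x ∨_) ([]=⇒lookup (x∈⁅x⁆ x)) ⟩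
  lookup p x ∨ true            ≡⟨ ∨-zeroʳ _ ⟩
  true                         ∎
  where open ≡-Reasoning

lookup-∪⁅x⁆-other : ∀ {n} (p : Subset n) {x y} → y ≢ x → lookup (p ∪ ⁅ x ⁆) y ≡ lookup p y
lookup-∪⁅x⁆-other p {x} {y} y≢x = begin
  lookup (p ∪ ⁅ x ⁆) y         ≡⟨ lookup-zipWith _∨_ y p ⁅ x ⁆ ⟩
  lookup p y ∨ lookup ⁅ x ⁆ y  ≡⟨ cong (lookup p y ∨_) (lookup-∉ (x≢y⇒x∉⁅y⁆ y≢x)) ⟩
  lookup p y ∨ false           ≡⟨ ∨-identityʳ _ ⟩
  lookup p y                   ∎
  where open ≡-Reasoning

σ'-fixes-or-moves : ∀ {n} (a b : Fin n) 𝓕 (F : Subset n) →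
  σ' a b 𝓕 F ≡ F ⊎
  (lookup F a ≡ true × lookup F b ≡ false × σ' a b 𝓕 F ≡ (F [ a ]≔ false) [ b ]≔ true)
σ'-fixes-or-moves a b 𝓕 F with σ a b F ∈ᶠ? 𝓕
... | true  = inj₁ refl
... | false with lookup F a | lookup F b
...   | true  | false = inj₂ (refl , refl , refl)
...   | true  | true  = inj₁ refl
...   | false | _     = inj₁ refl

moved-∪⁅⁆ : ∀ {n} {F p : Subset n} {a b} → lookup F a ≡ true → lookup F b ≡ false → b ∉ p →
  (F [ a ]≔ false) [ b ]≔ true ≡ p ∪ ⁅ b ⁆ → F ≡ p ∪ ⁅ a ⁆
moved-∪⁅⁆ {F = F} {p} {a} {b} Fa≡true Fb≡false b∉p moved≡ = Pointwise-≡⇒≡ (ext agree)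
  where
  open ≡-Reasoning
  agree : ∀ k → lookup F k ≡ lookup (p ∪ ⁅ a ⁆) k
  agree k with k ≟ a | k ≟ b
  ... | yes refl | _ = trans Fa≡true (sym (lookup-∪⁅x⁆-self p a))
  ... | no k≢a | yes refl = begin
    lookup F k            ≡⟨ Fb≡false ⟩
    false                 ≡⟨ sym (lookup-∉ b∉p) ⟩
    lookup p k            ≡⟨ sym (lookup-∪⁅x⁆-other p k≢a) ⟩
    lookup (p ∪ ⁅ a ⁆) k  ∎
  ... | no k≢a | no k≢b = begin
    lookup F k                                ≡⟨ sym (lookup∘update′ k≢a F false) ⟩
    lookup (F [ a ]≔ false) k                 ≡⟨ sym (lookup∘update′ k≢b (F [ a ]≔ false) true) ⟩
    lookup ((F [ a ]≔ false) [ b ]≔ true) k   ≡⟨ cong (λ q → lookup q k) moved≡ ⟩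
    lookup (p ∪ ⁅ b ⁆) k                      ≡⟨ lookup-∪⁅x⁆-other p k≢b ⟩
    lookup p k                                ≡⟨ sym (lookup-∪⁅x⁆-other p k≢a) ⟩
    lookup (p ∪ ⁅ a ⁆) k                      ∎

∪⁅⁆∈σᶠ⁻ : ∀ {n} {𝓕 : List (Subset n)} {p a b} → b ∉ p → (p ∪ ⁅ b ⁆) ∈ᶠ σᶠ a b 𝓕 →
  (p ∪ ⁅ b ⁆) ∈ᶠ 𝓕 ⊎ (p ∪ ⁅ a ⁆) ∈ᶠ 𝓕
∪⁅⁆∈σᶠ⁻ {𝓕 = 𝓕} {a = a} {b} b∉p p+b∈σ𝓕 with ∈-map⁻ (σ' a b 𝓕) p+b∈σ𝓕
... | F , F∈𝓕 , p+b≡σ'F with σ'-fixes-or-moves a b 𝓕 F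
...   | inj₁ σ'F≡F = inj₁ (subst (_∈ᶠ 𝓕) (sym (trans p+b≡σ'F σ'F≡F)) F∈𝓕)
...   | inj₂ (Fa≡true , Fb≡false , σ'F≡moved) =
  inj₂ (subst (_∈ᶠ 𝓕) (moved-∪⁅⁆ Fa≡true Fb≡false b∉p (sym (trans p+b≡σ'F σ'F≡moved))) F∈𝓕)

∪⁅⁆-meet⇒≡ : ∀ {n} {p q : Subset n} {x y} → Empty (p ∩ q) → x ∉ p → y ∉ q →
  Nonempty ((p ∪ ⁅ y ⁆) ∩ (q ∪ ⁅ x ⁆)) → x ≡ y
∪⁅⁆-meet⇒≡ {p = p} {q} {x} {y} p∩q-empty x∉p y∉q (k , k∈meet)
  with x∈p∩q⁻ (p ∪ ⁅ y ⁆) (q ∪ ⁅ x ⁆) k∈meet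
... | k∈p∪y , k∈q∪x with x∈p∪q⁻ p ⁅ y ⁆ k∈p∪y | x∈p∪q⁻ q ⁅ x ⁆ k∈q∪x
...   | inj₁ k∈p | inj₁ k∈q = contradiction (k , x∈p∩q⁺ (k∈p , k∈q)) p∩q-empty
...   | inj₁ k∈p | inj₂ k∈x = contradiction (subst (_∈ p) (x∈⁅y⁆⇒x≡y x k∈x) k∈p) x∉p
...   | inj₂ k∈y | inj₁ k∈q = contradiction (subst (_∈ q) (x∈⁅y⁆⇒x≡y y k∈y) k∈q) y∉q
...   | inj₂ k∈y | inj₂ k∈x = trans (sym (x∈⁅y⁆⇒x≡y x k∈x)) (x∈⁅y⁆⇒x≡y y k∈y)

∣p∪⁅x⁆∣≡1+∣p∣ : ∀ {n} (p : Subset n) {x} → x ∉ p → ∣ p ∪ ⁅ x ⁆ ∣ ≡ suc ∣ p ∣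
∣p∪⁅x⁆∣≡1+∣p∣ (true  ∷ p) {zero}  x∉p = contradiction here x∉p
∣p∪⁅x⁆∣≡1+∣p∣ (false ∷ p) {zero}  _   = cong (λ q → suc ∣ q ∣) (∪-identityʳ p)
∣p∪⁅x⁆∣≡1+∣p∣ (true  ∷ p) {suc x} x∉p = cong suc (∣p∪⁅x⁆∣≡1+∣p∣ p (x∉p ∘ there))
∣p∪⁅x⁆∣≡1+∣p∣ (false ∷ p) {suc x} x∉p = ∣p∪⁅x⁆∣≡1+∣p∣ p (x∉p ∘ there)

∣p∪q∣≤∣p∣+∣q∣ : ∀ {n} (p q : Subset n) → ∣ p ∪ q ∣ ≤ ∣ p ∣ + ∣ q ∣
∣p∪q∣≤∣p∣+∣q∣ []          []          = z≤n
∣p∪q∣≤∣p∣+∣q∣ (true  ∷ p) (true  ∷ q) = s≤s (≤-trans (∣p∪q∣≤∣p∣+∣q∣ p q) (+-monoʳ-≤ (∣ p ∣) (n≤1+n (∣ q ∣))))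
∣p∪q∣≤∣p∣+∣q∣ (true  ∷ p) (false ∷ q) = s≤s (∣p∪q∣≤∣p∣+∣q∣ p q)
∣p∪q∣≤∣p∣+∣q∣ (false ∷ p) (true  ∷ q) = ≤-trans (s≤s (∣p∪q∣≤∣p∣+∣q∣ p q)) (≤-reflexive (sym (+-suc (∣ p ∣) (∣ q ∣))))
∣p∪q∣≤∣p∣+∣q∣ (false ∷ p) (false ∷ q) = ∣p∪q∣≤∣p∣+∣q∣ p q

suc-twice : ∀ {u s t} → u + u ≡ s → 2 + s ≡ t → suc u + suc u ≡ t
suc-twice {u} refl refl = cong suc (+-suc u u)

∣p∪q∣+∣p∪q∣≡∣p∣+∣q∣+∣p△q∣ : ∀ {n} (p q : Subset n) →
  ∣ p ∪ q ∣ + ∣ p ∪ q ∣ ≡ ∣ p ∣ + ∣ q ∣ + ∣ p △ q ∣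
∣p∪q∣+∣p∪q∣≡∣p∣+∣q∣+∣p△q∣ []          []          = refl
∣p∪q∣+∣p∪q∣≡∣p∣+∣q∣+∣p△q∣ (true  ∷ p) (true  ∷ q) =
  suc-twice (∣p∪q∣+∣p∪q∣≡∣p∣+∣q∣+∣p△q∣ p q) (rearrange (∣ p ∣) (∣ q ∣) (∣ p △ q ∣))
  where
  rearrange : ∀ a b c → 2 + (a + b + c) ≡ suc a + suc b + c
  rearrange = solve-∀
∣p∪q∣+∣p∪q∣≡∣p∣+∣q∣+∣p△q∣ (true  ∷ p) (false ∷ q) =
  suc-twice (∣p∪q∣+∣p∪q∣≡∣p∣+∣q∣+∣p△q∣ p q) (rearrange (∣ p ∣) (∣ q ∣) (∣ p △ q ∣))
  where
  rearrange : ∀ a b c → 2 + (a + b + c) ≡ suc a + b + suc c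
  rearrange = solve-∀
∣p∪q∣+∣p∪q∣≡∣p∣+∣q∣+∣p△q∣ (false ∷ p) (true  ∷ q) =
  suc-twice (∣p∪q∣+∣p∪q∣≡∣p∣+∣q∣+∣p△q∣ p q) (rearrange (∣ p ∣) (∣ q ∣) (∣ p △ q ∣))
  where
  rearrange : ∀ a b c → 2 + (a + b + c) ≡ a + suc b + suc c
  rearrange = solve-∀
∣p∪q∣+∣p∪q∣≡∣p∣+∣q∣+∣p△q∣ (false ∷ p) (false ∷ q) = ∣p∪q∣+∣p∪q∣≡∣p∣+∣q∣+∣p△q∣ p q

∣p△q∣≡2⇒∣p∪q∣≡1+r : ∀ {n r} (p q : Subset n) → ∣ p ∣ ≡ r → ∣ q ∣ ≡ r → ∣ p △ q ∣ ≡ 2 →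
  ∣ p ∪ q ∣ ≡ suc r
∣p△q∣≡2⇒∣p∪q∣≡1+r {r = r} p q ∣p∣≡r ∣q∣≡r ∣p△q∣≡2 = +-self-injective (begin
  ∣ p ∪ q ∣ + ∣ p ∪ q ∣        ≡⟨ ∣p∪q∣+∣p∪q∣≡∣p∣+∣q∣+∣p△q∣ p q ⟩
  ∣ p ∣ + ∣ q ∣ + ∣ p △ q ∣    ≡⟨ cong₂ (λ a b → a + b + ∣ p △ q ∣) ∣p∣≡r ∣q∣≡r ⟩
  r + r + ∣ p △ q ∣            ≡⟨ cong (r + r +_) ∣p△q∣≡2 ⟩
  r + r + 2                    ≡⟨ solve (r List.∷ List.[]) ⟩
  suc r + suc r                ∎)
  where
  open ≡-Reasoning
  +-self-injective : ∀ {m n} → m + m ≡ n + n → m ≡ n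
  +-self-injective {m} {n} eq = trans (n≡⌊n+n/2⌋ m) (trans (cong ⌊_/2⌋ eq) (sym (n≡⌊n+n/2⌋ n)))

subset-of-size : ∀ {n} (p : Subset n) {k} → k ≤ ∣ p ∣ → ∃[ q ] q ⊆ p × ∣ q ∣ ≡ k
subset-of-size {n} p {zero} _ = ⊥ , ⊆-min p , ∣⊥∣≡0 n
subset-of-size (true ∷ p) {suc k} (s≤s k≤∣p∣) with subset-of-size p k≤∣p∣
... | q , q⊆p , ∣q∣≡k = true ∷ q , s⊆s q⊆p , cong suc ∣q∣≡k
subset-of-size (false ∷ p) {suc k} k<∣p∣ with subset-of-size p k<∣p∣
... | q , q⊆p , ∣q∣≡k = false ∷ q , out⊆ q⊆p , ∣q∣≡k

common-disjoint-subset : ∀ {n r} (E p q : Subset n) → ∣ p ∣ ≡ r → ∣ q ∣ ≡ r → ∣ p △ q ∣ ≡ 2 →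
  r + (∣ E ∣ + suc r) ≤ n → ∃[ t ] t ⊆ ⊤ ─ E × ∣ t ∣ ≡ r × Empty (p ∩ t) × Empty (t ∩ q)
common-disjoint-subset {n} {r} E p q ∣p∣≡r ∣q∣≡r ∣p△q∣≡2 r+∣E∣+1+r≤n
  with subset-of-size (∁ (E ∪ (p ∪ q))) r≤∣∁U∣
  where
  r≤∣∁U∣ : r ≤ ∣ ∁ (E ∪ (p ∪ q)) ∣
  r≤∣∁U∣ = subst (r ≤_) (sym (∣∁p∣≡n∸∣p∣ (E ∪ (p ∪ q)))) (m+n≤o⇒m≤o∸n r (begin
    r + ∣ E ∪ (p ∪ q) ∣        ≤⟨ +-monoʳ-≤ r (∣p∪q∣≤∣p∣+∣q∣ E (p ∪ q)) ⟩
    r + (∣ E ∣ + ∣ p ∪ q ∣)    ≡⟨ cong (λ u → r + (∣ E ∣ + u)) (∣p△q∣≡2⇒∣p∪q∣≡1+r p q ∣p∣≡r ∣q∣≡r ∣p△q∣≡2) ⟩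
    r + (∣ E ∣ + suc r)        ≤⟨ r+∣E∣+1+r≤n ⟩
    n                          ∎))
    where open ≤-Reasoning
... | t , t⊆∁U , ∣t∣≡r =
  t , (λ x∈t → x∈p∧x∉q⇒x∈p─q ∈⊤ (avoids x∈t ∘ p⊆p∪q (p ∪ q))) , ∣t∣≡r ,
  (λ (_ , x∈p∩t) → let x∈p , x∈t = x∈p∩q⁻ p t x∈p∩t in avoids x∈t (p⊆U x∈p)) ,
  (λ (_ , x∈t∩q) → let x∈t , x∈q = x∈p∩q⁻ t q x∈t∩q in avoids x∈t (q⊆U x∈q))
  where
  avoids : ∀ {x} → x ∈ t → x ∉ E ∪ (p ∪ q)
  avoids = x∈∁p⇒x∉p ∘ t⊆∁U
  p⊆U : p ⊆ E ∪ (p ∪ q)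
  p⊆U = q⊆p∪q E (p ∪ q) ∘ p⊆p∪q q
  q⊆U : q ⊆ E ∪ (p ∪ q)
  q⊆U = q⊆p∪q E (p ∪ q) ∘ q⊆p∪q p q

∣⁅x⁆∪⁅y⁆∣≤2 : ∀ {n} (x y : Fin n) → ∣ ⁅ x ⁆ ∪ ⁅ y ⁆ ∣ ≤ 2
∣⁅x⁆∪⁅y⁆∣≤2 x y = ≤-trans (∣p∪q∣≤∣p∣+∣q∣ ⁅ x ⁆ ⁅ y ⁆) (≤-reflexive (cong₂ _+_ (∣⁅x⁆∣≡1 x) (∣⁅x⁆∣≡1 y)))

room-for-two-disjoint : ∀ {n r e} → e ≤ 2 → 2 * suc r < n → r + (e + suc r) ≤ n
room-for-two-disjoint {n} {r} {e} e≤2 2r+2<n = begin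
  r + (e + suc r)   ≤⟨ +-monoʳ-≤ r (+-monoˡ-≤ (suc r) e≤2) ⟩
  r + (2 + suc r)   ≡⟨ solve (r List.∷ List.[]) ⟩
  suc (2 * suc r)   ≤⟨ 2r+2<n ⟩
  n                 ∎
  where open ≤-Reasoning

p⊆q─r∧x∈r⇒x∉p : ∀ {n} {p q r : Subset n} {x} → p ⊆ q ─ r → x ∈ r → x ∉ p
p⊆q─r∧x∈r⇒x∉p {q = q} {r} p⊆q─r x∈r x∈p = x∈p─q⇒x∉q q r (p⊆q─r x∈p) x∈r

proposition8 : (n r : ℕ) → 1 ≤ r → 2 * r < n →
    (𝓕 : List (Subset n)) → Unique 𝓕 → Uniform r 𝓕 → Intersecting 𝓕 →
    length 𝓕 ≡ (n ∸ 1) C (r ∸ 1) →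
    (i j : Fin n) → IsFullStar r i (σᶠ j i 𝓕) →
    ((A C : Subset n) → A ⊆ ⊤ ─ (⁅ i ⁆ ∪ ⁅ j ⁆) → ∣ A ∣ ≡ r ∸ 1 →
       C ⊆ ⊤ ─ (⁅ i ⁆ ∪ ⁅ j ⁆) → ∣ C ∣ ≡ r ∸ 1 →
       Empty (A ∩ C) → (A ∪ ⁅ j ⁆) ∈ᶠ 𝓕 → (C ∪ ⁅ j ⁆) ∈ᶠ 𝓕)
    × ((A B : Subset n) → A ⊆ ⊤ ─ (⁅ i ⁆ ∪ ⁅ j ⁆) → ∣ A ∣ ≡ r ∸ 1 →
       B ⊆ ⊤ ─ (⁅ i ⁆ ∪ ⁅ j ⁆) → ∣ B ∣ ≡ r ∸ 1 →
       ∣ A △ B ∣ ≡ 2 → (A ∪ ⁅ j ⁆) ∈ᶠ 𝓕 → (B ∪ ⁅ j ⁆) ∈ᶠ 𝓕)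
proposition8 n (suc r) (s≤s z≤n) 2r+2<n 𝓕 _ _ 𝓕-intersecting _ i j σ𝓕-star =
  disjoint-closed , adjacent-closed
  where
  M : Subset n
  M = ⊤ ─ (⁅ i ⁆ ∪ ⁅ j ⁆)

  i∉ : ∀ {X} → X ⊆ M → i ∉ X
  i∉ X⊆M = p⊆q─r∧x∈r⇒x∉p X⊆M (p⊆p∪q ⁅ j ⁆ (x∈⁅x⁆ i))

  j∉ : ∀ {X} → X ⊆ M → j ∉ X
  j∉ X⊆M = p⊆q─r∧x∈r⇒x∉p X⊆M (q⊆p∪q ⁅ i ⁆ ⁅ j ⁆ (x∈⁅x⁆ j))

  with-i-or-with-j : ∀ {X} → X ⊆ M → ∣ X ∣ ≡ r → (X ∪ ⁅ i ⁆) ∈ᶠ 𝓕 ⊎ (X ∪ ⁅ j ⁆) ∈ᶠ 𝓕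
  with-i-or-with-j {X} X⊆M ∣X∣≡r = ∪⁅⁆∈σᶠ⁻ (i∉ X⊆M) (proj₂ (σ𝓕-star (X ∪ ⁅ i ⁆))
    (trans (∣p∪⁅x⁆∣≡1+∣p∣ X (i∉ X⊆M)) (cong suc ∣X∣≡r) , q⊆p∪q X ⁅ i ⁆ (x∈⁅x⁆ i)))

  disjoint-closed : (A C : Subset n) → A ⊆ M → ∣ A ∣ ≡ r → C ⊆ M → ∣ C ∣ ≡ r →
    Empty (A ∩ C) → (A ∪ ⁅ j ⁆) ∈ᶠ 𝓕 → (C ∪ ⁅ j ⁆) ∈ᶠ 𝓕
  disjoint-closed A C A⊆M _ C⊆M ∣C∣≡r A∩C-empty A∪j∈𝓕 = [ from-i , id ] (with-i-or-with-j C⊆M ∣C∣≡r)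
    where
    from-i : (C ∪ ⁅ i ⁆) ∈ᶠ 𝓕 → (C ∪ ⁅ j ⁆) ∈ᶠ 𝓕
    from-i C∪i∈𝓕 = subst (λ x → (C ∪ ⁅ x ⁆) ∈ᶠ 𝓕)
      (∪⁅⁆-meet⇒≡ A∩C-empty (i∉ A⊆M) (j∉ C⊆M) (𝓕-intersecting A∪j∈𝓕 C∪i∈𝓕)) C∪i∈𝓕

  adjacent-closed : (A B : Subset n) → A ⊆ M → ∣ A ∣ ≡ r → B ⊆ M → ∣ B ∣ ≡ r →
    ∣ A △ B ∣ ≡ 2 → (A ∪ ⁅ j ⁆) ∈ᶠ 𝓕 → (B ∪ ⁅ j ⁆) ∈ᶠ 𝓕
  adjacent-closed A B A⊆M ∣A∣≡r B⊆M ∣B∣≡r ∣A△B∣≡2 A∪j∈𝓕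
    with common-disjoint-subset (⁅ i ⁆ ∪ ⁅ j ⁆) A B ∣A∣≡r ∣B∣≡r ∣A△B∣≡2
           (room-for-two-disjoint (∣⁅x⁆∪⁅y⁆∣≤2 i j) 2r+2<n)
  ... | T , T⊆M , ∣T∣≡r , A∩T-empty , T∩B-empty =
    disjoint-closed T B T⊆M ∣T∣≡r B⊆M ∣B∣≡r T∩B-empty
      (disjoint-closed A T A⊆M ∣A∣≡r T⊆M ∣T∣≡r A∩T-empty A∪j∈𝓕)
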